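{- Let $\Delta=(N_1,\dots,N_l)$ be a partition of $n$ with $N_1\le\dots\le N_l\le p$, let $z\in M(d,n;\mathbb{F}_q)$ and let $\chi$ be a character of $H_\Delta$. Then: (i) for every $g\in GL_d(\mathbb{F}_q)$, $\Phi_\Delta(\chi;gz)=\Phi_\Delta(\chi;z)$; (ii) for every $h\in H_\Delta$, $\Phi_\Delta(\chi;zh)=\chi(h)\Phi_\Delta(\chi;z)$.
   Context: $q$ is a power of a prime $p$, $\psi$ a fixed nontrivial additive character of $\mathbb{F}_q$, $\psi_a(x)=\psi(ax)$; multiplicative characters satisfy $\alpha(0)=0$. For $m\ge1$ let $\Lambda$ be the $m\times m$ matrix with $1$'s on the superdiagonal and $0$ elsewhere, $[h_0,\dots,h_{m-1}]=\sum_i h_i\Lambda^i$, and $J(m)=\{[h_0,\dots,h_{m-1}]:h_0\in\mathbb{F}_q^*,h_i\in\mathbb{F}_q\}$. For $x=(x_0,x_1,\dots)$, $X_j=x_j/x_0$, let $\theta_i(x)=\sum_{k_1+2k_2+\dots+ik_i=i,\,k_j\ge0}(-1)^{k_1+\dots+k_i-1}\frac{(k_1+\dots+k_i-1)!}{k_1!\cdots k_i!}X_1^{k_1}\cdots X_i^{k_i}$ and $\theta_i([h_0,\dots,h_{m-1}])=\theta_i(h_0,\dots,h_i)$. For $p\ge m$ the characters of $J(m)$ are exactly the maps $(\alpha,a_1,\dots,a_{m-1})\colon h\mapsto\alpha(h_0)\prod_{i=1}^{m-1}\psi(a_i\theta_i(h))$ with $\alpha$ a character of $\mathbb{F}_q^*$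 and $a_i\in\mathbb{F}_q$. $H_\Delta=\{\mathrm{diag}(h_1,\dots,h_l): h_i\in J(N_i)\}\subset GL_n(\mathbb{F}_q)$; a character of $H_\Delta$ is $\chi=(\chi_1,\dots,\chi_l)$ with $\chi_i$ a character of $J(N_i)$ and $\chi(\mathrm{diag}(h_1,\dots,h_l))=\prod\chi_i(h_i)$. Write $z=(z^{(1)},\dots,z^{(l)})$ with $z^{(i)}=(z^{(i)}_0,\dots,z^{(i)}_{N_i-1})$ the consecutive columns of $z$ in the $i$-th block. For a row vector $s\in\mathbb{F}_q^d$ put $\chi_i(sz^{(i)})=\chi_i([sz^{(i)}_0,\dots,sz^{(i)}_{N_i-1}])$ if $sz^{(i)}_0\ne0$ and $\chi_i(sz^{(i)})=0$ otherwise, and $\chi(sz)=\prod_{i=1}^l\chi_i(sz^{(i)})$. The general hypergeometric function over $\mathbb{F}_q$ is $\Phi_\Delta(\chi;z)=\sum_{s\in\mathbb{F}_q^d}\chi(sz)$. -}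

module Defs where

open import Level using (Level; _⊔_)
open import Data.Nat as ℕ using (ℕ; zero; suc; _∸_; _≤ᵇ_)
open import Data.Nat.Primality using (Prime)
open import Data.Bool using (if_then_else_)
open import Data.Fin as Fin using (Fin; zero; suc; toℕ; _↑ˡ_; _↑ʳ_; splitAt)
open import Data.Sum using (_⊎_; inj₁; inj₂)
open import Data.Vec as Vec using (Vec; []; _∷_; lookup; tabulate)
open import Data.List using (List; []; _∷_; length)
open import Data.List.Membership.Propositional using (_∈_)
open import Data.List.Relation.Unary.Unique.Propositional using (Unique)
open import Data.Product using (Σ; _×_; _,_)
open import Relation.Binary.PropositionalEquality using (_≡_; _≢_)
open import Relation.Binary.Definitions using (DecidableEquality)
open import Algebra.Core using (Op₁; Op₂)
open import Relation.Nullary using (yes; no)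
open import Algebra.Structures using (IsCommutativeRing)
open import Algebra.Bundles using (CommutativeRing)

natTimes : {A : Set} → Op₂ A → A → A → ℕ → A
natTimes _+_ z x zero    = z
natTimes _+_ z x (suc n) = x + natTimes _+_ z x n

record FiniteField : Set₁ where
  field
    Carrier           : Set
    _+_ _*_           : Op₂ Carrier
    -_                : Op₁ Carrier
    0# 1#             : Carrier
    isCommutativeRing : IsCommutativeRing _≡_ _+_ _*_ -_ 0# 1#
    _⁻¹               : Carrier → Carrier
    inverseʳ          : ∀ x → x ≢ 0# → x * (x ⁻¹) ≡ 1#
    0≢1               : 0# ≢ 1#
    _≟_               : DecidableEquality Carrier
    elements          : List Carrier
    elements-unique   : Unique elements
    elements-complete : ∀ x → x ∈ elements
    p                 : ℕ
    p-prime           : Prime p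
    char-p            : natTimes _+_ 0# 1# p ≡ 0#

  q : ℕ
  q = length elements

-- Everything below is relative to a finite field F and a commutative ring R
-- in which characters take their values (the paper uses R = ℂ).
module Hyper (F : FiniteField) {c ℓ : Level} (R : CommutativeRing c ℓ) where
  open FiniteField F using (_≟_; elements) renaming (Carrier to 𝔽; _+_ to _+F_; _*_ to _*F_; 0# to 0F; 1# to 1F)
  open CommutativeRing R using (_≈_; _+_; _*_; 0#; 1#) renaming (Carrier to ℛ)

  _≈ᴿ_ : ℛ → ℛ → Set ℓ
  _≈ᴿ_ = _≈_

  _*ᴿ_ : ℛ → ℛ → ℛ
  _*ᴿ_ = _*_

  Matrix : ℕ → ℕ → Set
  Matrix a b = Fin a → Fin b → 𝔽

  ΣF : {k : ℕ} → (Fin k → 𝔽) → 𝔽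
  ΣF {zero}  f = 0F
  ΣF {suc k} f = f zero +F ΣF (λ i → f (suc i))

  ΠR : {k : ℕ} → (Fin k → ℛ) → ℛ
  ΠR {zero}  f = 1#
  ΠR {suc k} f = f zero * ΠR (λ i → f (suc i))

  ΣList : List 𝔽 → (𝔽 → ℛ) → ℛ
  ΣList []       f = 0#
  ΣList (x ∷ xs) f = f x + ΣList xs f

  ΣVec : (d : ℕ) → (Vec 𝔽 d → ℛ) → ℛ
  ΣVec zero    f = f []
  ΣVec (suc d) f = ΣList elements (λ x → ΣVec d (λ v → f (x ∷ v)))

  _·_ : {a b c' : ℕ} → Matrix a b → Matrix b c' → Matrix a c'
  (A · B) i k = ΣF (λ j → A i j *F B j k)

  identity : {a : ℕ} → Matrix a a
  identity i j = if toℕ i ℕ.≡ᵇ toℕ j then 1F else 0F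

  IsInvertible : {d : ℕ} → Matrix d d → Set
  IsInvertible {d} g = Σ (Matrix d d) λ g' →
    (∀ i j → (g · g') i j ≡ identity i j) × (∀ i j → (g' · g) i j ≡ identity i j)

  -- h_k, with the convention h_k = 0 for k ≥ m
  lookupℕ : {m : ℕ} → Vec 𝔽 m → ℕ → 𝔽
  lookupℕ []       _       = 0F
  lookupℕ (x ∷ xs) zero    = x
  lookupℕ (x ∷ xs) (suc k) = lookupℕ xs k

  -- [h_0,...,h_{m-1}] = Σ h_i Λ^i  as an m×m matrix
  jmat : {m : ℕ} → Vec 𝔽 m → Matrix m m
  jmat h r c' = if toℕ r ≤ᵇ toℕ c' then lookupℕ h (toℕ c' ∸ toℕ r) else 0F

  InJ : {m : ℕ} → Vec 𝔽 m → Set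
  InJ h = lookupℕ h 0 ≢ 0F

  -- group law of J(m): [h][h'] = [h ⋆ h'] (truncated convolution)
  _⋆_ : {m : ℕ} → Vec 𝔽 m → Vec 𝔽 m → Vec 𝔽 m
  h ⋆ h' = tabulate λ k → ΣF λ r →
    if toℕ r ≤ᵇ toℕ k then lookup h r *F lookupℕ h' (toℕ k ∸ toℕ r) else 0F

  unitJ : {m : ℕ} → Vec 𝔽 m
  unitJ = tabulate λ k → if toℕ k ℕ.≡ᵇ 0 then 1F else 0F

  -- a character of J(m): a homomorphism J(m) → R^× (values on non-members are irrelevant)
  record JChar (m : ℕ) : Set (c ⊔ ℓ) where
    field
      χ   : Vec 𝔽 m → ℛ
      hom : ∀ h h' → InJ h → InJ h' → χ (h ⋆ h') ≈ χ h * χ h'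
      one : χ unitJ ≈ 1#

  -- χ_i(v) with the convention χ_i(v) = 0 when v_0 = 0
  evalJ : {m : ℕ} → JChar m → Vec 𝔽 m → ℛ
  evalJ ch v with lookupℕ v 0 ≟ 0F
  ... | yes _ = 0#
  ... | no  _ = JChar.χ ch v

  -- column index in M(d,n) of the j-th column of the i-th block, n = N_1+...+N_l
  col : {l : ℕ} (N : Vec ℕ l) (i : Fin l) → Fin (lookup N i) → Fin (Vec.sum N)
  col (m ∷ N) zero    j = j ↑ˡ Vec.sum N
  col (m ∷ N) (suc i) j = m ↑ʳ col N i j

  CharH : {l : ℕ} → Vec ℕ l → Set (c ⊔ ℓ)
  CharH {l} N = (i : Fin l) → JChar (lookup N i)

  -- s z^{(i)} = (s z^{(i)}_0, ..., s z^{(i)}_{N_i - 1})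
  block : {l d : ℕ} (N : Vec ℕ l) → Vec 𝔽 d → Matrix d (Vec.sum N) → (i : Fin l) → Vec 𝔽 (lookup N i)
  block N s z i = tabulate λ j → ΣF λ r → lookup s r *F z r (col N i j)

  Φ : {l d : ℕ} (N : Vec ℕ l) → CharH N → Matrix d (Vec.sum N) → ℛ
  Φ {l} {d} N ch z = ΣVec d λ s → ΠR λ i → evalJ (ch i) (block N s z i)

  Elems : {l : ℕ} → Vec ℕ l → Set
  Elems {l} N = (i : Fin l) → Vec 𝔽 (lookup N i)

  InH : {l : ℕ} (N : Vec ℕ l) → Elems N → Set
  InH N hs = ∀ i → InJ (hs i)

  blockDiag : {l : ℕ} (N : Vec ℕ l) → Elems N → Matrix (Vec.sum N) (Vec.sum N)
  blockDiag [] hs a b = 0F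
  blockDiag (m ∷ N) hs a b = go (splitAt m a) (splitAt m b)
    where
      go : Fin m ⊎ Fin (Vec.sum N) → Fin m ⊎ Fin (Vec.sum N) → 𝔽
      go (inj₁ x) (inj₁ y) = jmat (hs zero) x y
      go (inj₂ x) (inj₂ y) = blockDiag N (λ i → hs (suc i)) x y
      go _        _        = 0F

  evalH : {l : ℕ} (N : Vec ℕ l) → CharH N → Elems N → ℛ
  evalH N ch hs = ΠR λ i → JChar.χ (ch i) (hs i)

-- Both identities hold summand by summand after a change of variables.  For (i), the
-- block of s (g z) is the block of s' z with s' = s g, and s ↦ s g permutes F_q^d when g
-- is invertible.  For (ii), right multiplication by diag(h_1, …, h_l) acts on the block
-- s z^{(i)} through the group law of J(N_i), (s z^{(i)}) ⋆ h_i, so each factor χ_i is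
-- multiplied by χ_i(h_i); the convention χ_i(v) = 0 when v_0 = 0 is respected because
-- (v ⋆ h)_0 = v_0 h_0 with h_0 ≠ 0.
module Submission where

open import Defs
open import Level using (Level)
open import Data.Nat using (ℕ; _≤_)
open import Data.Fin using (Fin) renaming (_≤_ to _≤ᶠ_)
open import Data.Vec using (Vec; lookup; sum)
open import Data.Product using (_×_)
open import Algebra.Bundles using (CommutativeRing)

open import Data.Nat as ℕ using (zero; suc)
open import Data.Fin using (zero; suc; toℕ; _↑ˡ_; _↑ʳ_)
open import Data.Fin.Properties using (splitAt-↑ˡ; splitAt-↑ʳ)
open import Data.Vec using ([]; _∷_; tabulate)
open import Data.Vec.Properties using (tabulate∘lookup; lookup∘tabulate; tabulate-cong; ≡-dec; ∷-injectiveˡ; ∷-injectiveʳ)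
open import Data.List using ([]; _∷_)
open import Data.List.Membership.Propositional using (_∈_)
open import Data.List.Relation.Unary.Any using (here; there)
open import Data.List.Relation.Unary.All as All using (All; []; _∷_)
open import Data.List.Relation.Unary.AllPairs using (_∷_)
open import Data.List.Relation.Unary.Unique.Propositional using (Unique)
open import Data.Bool using (if_then_else_)
open import Data.Bool.Properties using (if-float; if-cong-else)
open import Data.Empty using (⊥-elim)
open import Data.Product using (_,_)
open import Function using (_∘_)
open import Relation.Nullary using (yes; no)
open import Relation.Binary.PropositionalEquality as ≡ using (_≡_; _≢_; cong; cong₂)
import Algebra.Properties.Semiring.Sum as SemiringSum
import Algebra.Properties.CommutativeMonoid.Sum as CommutativeMonoidSum
import Algebra.Properties.CommutativeSemigroup as CommutativeSemigroupProperties

module HypergeometricSymmetries (F : FiniteField) {c ℓ : Level} (R : CommutativeRing c ℓ) where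
  open Hyper F R
  open FiniteField F using (_≟_; elements; elements-unique; elements-complete; _⁻¹; inverseʳ)
    renaming (Carrier to 𝔽; _+_ to _+F_; _*_ to _*F_; 0# to 0F; 1# to 1F)

  𝔽-ring : CommutativeRing _ _
  𝔽-ring = record { isCommutativeRing = FiniteField.isCommutativeRing F }

  module 𝔽 = CommutativeRing 𝔽-ring
  module Σ𝔽 = SemiringSum 𝔽.semiring
  open CommutativeRing R hiding (zero)
  module ProductR = CommutativeMonoidSum *-commutativeMonoid
  open CommutativeSemigroupProperties +-commutativeSemigroup using (interchange)

  ΣF≡sum : ∀ {k} (f : Fin k → 𝔽) → ΣF f ≡ Σ𝔽.sum f
  ΣF≡sum {zero}  f = ≡.refl
  ΣF≡sum {suc k} f = cong (f zero +F_) (ΣF≡sum (f ∘ suc))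

  ΣF-cong : ∀ {k} {f g : Fin k → 𝔽} → (∀ i → f i ≡ g i) → ΣF f ≡ ΣF g
  ΣF-cong {zero}  f≗g = ≡.refl
  ΣF-cong {suc k} f≗g = cong₂ _+F_ (f≗g zero) (ΣF-cong (f≗g ∘ suc))

  ΣF-zero : ∀ {k} {f : Fin k → 𝔽} → (∀ i → f i ≡ 0F) → ΣF f ≡ 0F
  ΣF-zero {k} f≗0 rewrite ΣF-cong f≗0 | ΣF≡sum {k} (λ _ → 0F) = Σ𝔽.sum-replicate-zero k

  ΣF-comm : ∀ {m n} (f : Fin m → Fin n → 𝔽) → ΣF (λ i → ΣF (f i)) ≡ ΣF (λ j → ΣF (λ i → f i j))
  ΣF-comm f = begin
    ΣF (λ i → ΣF (f i))                   ≡⟨ ΣF≡sum (λ i → ΣF (f i)) ⟩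
    Σ𝔽.sum (λ i → ΣF (f i))               ≡⟨ Σ𝔽.sum-cong-≗ (λ i → ΣF≡sum (f i)) ⟩
    Σ𝔽.sum (λ i → Σ𝔽.sum (f i))           ≡⟨ Σ𝔽.∑-comm f ⟩
    Σ𝔽.sum (λ j → Σ𝔽.sum (λ i → f i j))   ≡⟨ Σ𝔽.sum-cong-≗ (λ j → ΣF≡sum (λ i → f i j)) ⟨
    Σ𝔽.sum (λ j → ΣF (λ i → f i j))       ≡⟨ ΣF≡sum (λ j → ΣF (λ i → f i j)) ⟨
    ΣF (λ j → ΣF (λ i → f i j))           ∎
    where open ≡.≡-Reasoning

  ΣF-*ˡ : ∀ {k} a (f : Fin k → 𝔽) → ΣF (λ i → a *F f i) ≡ a *F ΣF f
  ΣF-*ˡ a f rewrite ΣF≡sum (λ i → a *F f i) | ΣF≡sum f = ≡.sym (Σ𝔽.*-distribˡ-sum a f)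

  ΣF-*ʳ : ∀ {k} a (f : Fin k → 𝔽) → ΣF (λ i → f i *F a) ≡ ΣF f *F a
  ΣF-*ʳ a f rewrite ΣF≡sum (λ i → f i *F a) | ΣF≡sum f = ≡.sym (Σ𝔽.*-distribʳ-sum a f)

  ΣF-↑ : ∀ m {n} (f : Fin (m ℕ.+ n) → 𝔽) → ΣF f ≡ ΣF (λ x → f (x ↑ˡ n)) +F ΣF (λ y → f (m ↑ʳ y))
  ΣF-↑ zero    f = ≡.sym (𝔽.+-identityˡ _)
  ΣF-↑ (suc m) f = ≡.trans (cong (f zero +F_) (ΣF-↑ m (f ∘ suc))) (≡.sym (𝔽.+-assoc _ _ _))

  ΠR≡product : ∀ {k} (f : Fin k → Carrier) → ΠR f ≡ ProductR.sum f
  ΠR≡product {zero}  f = ≡.refl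
  ΠR≡product {suc k} f = cong (f zero *_) (ΠR≡product (f ∘ suc))

  ΠR-cong : ∀ {k} {f g : Fin k → Carrier} → (∀ i → f i ≈ g i) → ΠR f ≈ ΠR g
  ΠR-cong {f = f} {g} f≈g rewrite ΠR≡product f | ΠR≡product g = ProductR.sum-cong-≋ f≈g

  ΠR-* : ∀ {k} (f g : Fin k → Carrier) → ΠR (λ i → f i * g i) ≈ ΠR f * ΠR g
  ΠR-* f g rewrite ΠR≡product (λ i → f i * g i) | ΠR≡product f | ΠR≡product g = ProductR.∑-distrib-+ f g

  ΣList-cong : ∀ xs {f g : 𝔽 → Carrier} → (∀ x → f x ≈ g x) → ΣList xs f ≈ ΣList xs g
  ΣList-cong []       f≈g = refl
  ΣList-cong (x ∷ xs) f≈g = +-cong (f≈g x) (ΣList-cong xs f≈g)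

  ΣList-zero : ∀ {xs} {f : 𝔽 → Carrier} → All (λ x → f x ≈ 0#) xs → ΣList xs f ≈ 0#
  ΣList-zero []           = refl
  ΣList-zero (fx≈0 ∷ f≈0) = trans (+-cong fx≈0 (ΣList-zero f≈0)) (+-identityˡ 0#)

  ΣList-+ : ∀ xs (f g : 𝔽 → Carrier) → ΣList xs (λ x → f x + g x) ≈ ΣList xs f + ΣList xs g
  ΣList-+ []       f g = sym (+-identityˡ 0#)
  ΣList-+ (x ∷ xs) f g = trans (+-congˡ (ΣList-+ xs f g)) (interchange _ _ _ _)

  ΣList-*ˡ : ∀ xs a (f : 𝔽 → Carrier) → ΣList xs (λ x → a * f x) ≈ a * ΣList xs f
  ΣList-*ˡ []       a f = sym (zeroʳ a)
  ΣList-*ˡ (x ∷ xs) a f = trans (+-congˡ (ΣList-*ˡ xs a f)) (sym (distribˡ a _ _))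

  ΣList-single : ∀ {xs y} {f : 𝔽 → Carrier} → Unique xs → y ∈ xs → (∀ x → x ≢ y → f x ≈ 0#) →
                 ΣList xs f ≈ f y
  ΣList-single (x∉xs ∷ _) (here ≡.refl) f≈0 =
    trans (+-congˡ (ΣList-zero (All.map (λ x≢z → f≈0 _ (x≢z ∘ ≡.sym)) x∉xs))) (+-identityʳ _)
  ΣList-single (x∉xs ∷ xs!) (there y∈xs) f≈0 =
    trans (+-congʳ (f≈0 _ (All.lookup x∉xs y∈xs))) (trans (+-identityˡ _) (ΣList-single xs! y∈xs f≈0))

  ΣVec-cong : ∀ d {f g : Vec 𝔽 d → Carrier} → (∀ v → f v ≈ g v) → ΣVec d f ≈ ΣVec d g
  ΣVec-cong zero    f≈g = f≈g []
  ΣVec-cong (suc d) f≈g = ΣList-cong elements (λ x → ΣVec-cong d (λ v → f≈g (x ∷ v)))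

  ΣVec-zero : ∀ d {f : Vec 𝔽 d → Carrier} → (∀ v → f v ≈ 0#) → ΣVec d f ≈ 0#
  ΣVec-zero zero    f≈0 = f≈0 []
  ΣVec-zero (suc d) f≈0 = ΣList-zero {elements} (All.tabulate (λ {x} _ → ΣVec-zero d (λ v → f≈0 (x ∷ v))))

  ΣVec-+ : ∀ d (f g : Vec 𝔽 d → Carrier) → ΣVec d (λ v → f v + g v) ≈ ΣVec d f + ΣVec d g
  ΣVec-+ zero    f g = refl
  ΣVec-+ (suc d) f g =
    trans (ΣList-cong elements (λ x → ΣVec-+ d (f ∘ (x ∷_)) (g ∘ (x ∷_)))) (ΣList-+ elements _ _)

  ΣVec-*ˡ : ∀ d a (f : Vec 𝔽 d → Carrier) → ΣVec d (λ v → a * f v) ≈ a * ΣVec d f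
  ΣVec-*ˡ zero    a f = refl
  ΣVec-*ˡ (suc d) a f =
    trans (ΣList-cong elements (λ x → ΣVec-*ˡ d a (f ∘ (x ∷_)))) (ΣList-*ˡ elements a _)

  ΣList-ΣVec-comm : ∀ xs d (f : 𝔽 → Vec 𝔽 d → Carrier) →
                    ΣList xs (λ x → ΣVec d (f x)) ≈ ΣVec d (λ v → ΣList xs (λ x → f x v))
  ΣList-ΣVec-comm []       d f = sym (ΣVec-zero d (λ _ → refl))
  ΣList-ΣVec-comm (x ∷ xs) d f = trans (+-congˡ (ΣList-ΣVec-comm xs d f)) (sym (ΣVec-+ d (f x) _))

  ΣVec-comm : ∀ d e (f : Vec 𝔽 d → Vec 𝔽 e → Carrier) →
              ΣVec d (λ u → ΣVec e (f u)) ≈ ΣVec e (λ v → ΣVec d (λ u → f u v))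
  ΣVec-comm zero    e f = refl
  ΣVec-comm (suc d) e f = trans (ΣList-cong elements (λ x → ΣVec-comm d e (f ∘ (x ∷_))))
                                (ΣList-ΣVec-comm elements e (λ x v → ΣVec d (λ u → f (x ∷ u) v)))

  ΣVec-single : ∀ d (u : Vec 𝔽 d) {f : Vec 𝔽 d → Carrier} → (∀ v → v ≢ u → f v ≈ 0#) → ΣVec d f ≈ f u
  ΣVec-single zero    []      f≈0 = refl
  ΣVec-single (suc d) (y ∷ u) f≈0 =
    trans (ΣList-single elements-unique (elements-complete y)
                        (λ x x≢y → ΣVec-zero d (λ v → f≈0 (x ∷ v) (x≢y ∘ ∷-injectiveˡ))))
          (ΣVec-single d u (λ v v≢u → f≈0 (y ∷ v) (v≢u ∘ ∷-injectiveʳ)))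

  ΣVec-reindex : ∀ d (σ τ : Vec 𝔽 d → Vec 𝔽 d) → (∀ u → τ (σ u) ≡ u) → (∀ v → σ (τ v) ≡ v) →
                 (f : Vec 𝔽 d → Carrier) → ΣVec d (f ∘ σ) ≈ ΣVec d f
  ΣVec-reindex d σ τ τσ στ f = begin
    ΣVec d (f ∘ σ)                           ≈⟨ ΣVec-cong d (λ u → trans (ΣVec-single d (σ u) (off-graph u)) (on-graph u (σ u) ≡.refl)) ⟨
    ΣVec d (λ u → ΣVec d (λ v → [ u ↦ v ]))  ≈⟨ ΣVec-comm d d _ ⟩
    ΣVec d (λ v → ΣVec d (λ u → [ u ↦ v ]))  ≈⟨ ΣVec-cong d (λ v → ΣVec-single d (τ v) (off-graph′ v)) ⟩
    ΣVec d (λ v → [ τ v ↦ v ])               ≈⟨ ΣVec-cong d (λ v → on-graph (τ v) v (≡.sym (στ v))) ⟩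
    ΣVec d f                                 ∎
    where
    open import Relation.Binary.Reasoning.Setoid setoid
    [_↦_] : Vec 𝔽 d → Vec 𝔽 d → Carrier
    [ u ↦ v ] with ≡-dec _≟_ v (σ u)
    ... | yes _ = f v
    ... | no  _ = 0#
    on-graph : ∀ u v → v ≡ σ u → [ u ↦ v ] ≈ f v
    on-graph u v v≡σu with ≡-dec _≟_ v (σ u)
    ... | yes _     = refl
    ... | no v≢σu   = ⊥-elim (v≢σu v≡σu)
    off-graph : ∀ u v → v ≢ σ u → [ u ↦ v ] ≈ 0#
    off-graph u v v≢σu with ≡-dec _≟_ v (σ u)
    ... | yes v≡σu = ⊥-elim (v≢σu v≡σu)
    ... | no  _    = refl
    off-graph′ : ∀ v u → u ≢ τ v → [ u ↦ v ] ≈ 0#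
    off-graph′ v u u≢τv = off-graph u v (λ v≡σu → u≢τv (≡.trans (≡.sym (τσ u)) (cong τ (≡.sym v≡σu))))

  infixl 7 _·ᵣ_ _·ᵥ_

  _·ᵣ_ : ∀ {a b} → (Fin a → 𝔽) → Matrix a b → Fin b → 𝔽
  (w ·ᵣ A) k = ΣF (λ r → w r *F A r k)

  _·ᵥ_ : ∀ {a b} → Vec 𝔽 a → Matrix a b → Vec 𝔽 b
  s ·ᵥ A = tabulate (lookup s ·ᵣ A)

  ·ᵣ-congˡ : ∀ {a b} {w w′ : Fin a → 𝔽} (A : Matrix a b) → (∀ r → w r ≡ w′ r) → ∀ k → (w ·ᵣ A) k ≡ (w′ ·ᵣ A) k
  ·ᵣ-congˡ A w≗w′ k = ΣF-cong (λ r → cong (_*F A r k) (w≗w′ r))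

  ·ᵣ-congʳ : ∀ {a b} (w : Fin a → 𝔽) {A B : Matrix a b} → (∀ r k → A r k ≡ B r k) → ∀ k → (w ·ᵣ A) k ≡ (w ·ᵣ B) k
  ·ᵣ-congʳ w A≗B k = ΣF-cong (λ r → cong (w r *F_) (A≗B r k))

  ·ᵣ-assoc : ∀ {a b e} (w : Fin a → 𝔽) (A : Matrix a b) (B : Matrix b e) k →
             (w ·ᵣ (A · B)) k ≡ ((w ·ᵣ A) ·ᵣ B) k
  ·ᵣ-assoc w A B k = begin
    ΣF (λ r → w r *F ΣF (λ j → A r j *F B j k))    ≡⟨ ΣF-cong (λ r → ΣF-*ˡ (w r) (λ j → A r j *F B j k)) ⟨
    ΣF (λ r → ΣF (λ j → w r *F (A r j *F B j k)))  ≡⟨ ΣF-cong (λ r → ΣF-cong (λ j → 𝔽.*-assoc (w r) (A r j) (B j k))) ⟨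
    ΣF (λ r → ΣF (λ j → (w r *F A r j) *F B j k))  ≡⟨ ΣF-comm (λ r j → (w r *F A r j) *F B j k) ⟩
    ΣF (λ j → ΣF (λ r → (w r *F A r j) *F B j k))  ≡⟨ ΣF-cong (λ j → ΣF-*ʳ (B j k) (λ r → w r *F A r j)) ⟩
    ((w ·ᵣ A) ·ᵣ B) k                              ∎
    where open ≡.≡-Reasoning

  ·ᵣ-identity : ∀ {a} (w : Fin a → 𝔽) k → (w ·ᵣ identity) k ≡ w k
  ·ᵣ-identity {suc a} w zero =
    ≡.trans (cong₂ _+F_ (𝔽.*-identityʳ (w zero)) (ΣF-zero (λ j → 𝔽.zeroʳ (w (suc j))))) (𝔽.+-identityʳ (w zero))
  ·ᵣ-identity {suc a} w (suc k) =
    ≡.trans (cong₂ _+F_ (𝔽.zeroʳ (w zero)) (·ᵣ-identity (w ∘ suc) k)) (𝔽.+-identityˡ (w (suc k)))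

  lookup-·ᵥ-·ᵣ : ∀ {a b e} (s : Vec 𝔽 a) (A : Matrix a b) (B : Matrix b e) k →
                 (lookup (s ·ᵥ A) ·ᵣ B) k ≡ (lookup s ·ᵣ (A · B)) k
  lookup-·ᵥ-·ᵣ s A B k =
    ≡.trans (·ᵣ-congˡ B (lookup∘tabulate (lookup s ·ᵣ A)) k) (≡.sym (·ᵣ-assoc (lookup s) A B k))

  ·ᵥ-inverse : ∀ {d} (g g′ : Matrix d d) → (∀ i j → (g · g′) i j ≡ identity i j) →
               ∀ s → (s ·ᵥ g) ·ᵥ g′ ≡ s
  ·ᵥ-inverse g g′ gg′≡1 s = ≡.trans (tabulate-cong λ k → begin
    (lookup (s ·ᵥ g) ·ᵣ g′) k    ≡⟨ lookup-·ᵥ-·ᵣ s g g′ k ⟩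
    (lookup s ·ᵣ (g · g′)) k     ≡⟨ ·ᵣ-congʳ (lookup s) gg′≡1 k ⟩
    (lookup s ·ᵣ identity) k     ≡⟨ ·ᵣ-identity (lookup s) k ⟩
    lookup s k                   ∎) (tabulate∘lookup s)
    where open ≡.≡-Reasoning

  block-· : ∀ {l d} (N : Vec ℕ l) (s : Vec 𝔽 d) (g : Matrix d d) (z : Matrix d (sum N)) i →
            block N s (g · z) i ≡ block N (s ·ᵥ g) z i
  block-· N s g z i = tabulate-cong (λ j → ≡.sym (lookup-·ᵥ-·ᵣ s g z (col N i j)))

  Φ-left-invariant : ∀ {l d} (N : Vec ℕ l) (χ : CharH N) (z : Matrix d (sum N)) (g : Matrix d d) →
                     IsInvertible g → Φ N χ (g · z) ≈ Φ N χ z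
  Φ-left-invariant {d = d} N χ z g (g′ , gg′≡1 , g′g≡1) = begin
    Φ N χ (g · z)
      ≈⟨ ΣVec-cong d (λ s → ΠR-cong (λ i → reflexive (cong (evalJ (χ i)) (block-· N s g z i)))) ⟩
    ΣVec d (λ s → term (s ·ᵥ g))
      ≈⟨ ΣVec-reindex d (_·ᵥ g) (_·ᵥ g′) (·ᵥ-inverse g g′ gg′≡1) (·ᵥ-inverse g′ g g′g≡1) term ⟩
    Φ N χ z
      ∎
    where
    open import Relation.Binary.Reasoning.Setoid setoid
    term : Vec 𝔽 d → Carrier
    term s = ΠR (λ i → evalJ (χ i) (block N s z i))

  module _ (m : ℕ) {l} (N : Vec ℕ l) (hs : Elems (m ∷ N)) where

    blockDiag-↑ˡ-↑ˡ : ∀ x y → blockDiag (m ∷ N) hs (x ↑ˡ sum N) (y ↑ˡ sum N) ≡ jmat (hs zero) x y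
    blockDiag-↑ˡ-↑ˡ x y rewrite splitAt-↑ˡ m x (sum N) | splitAt-↑ˡ m y (sum N) = ≡.refl

    blockDiag-↑ʳ-↑ˡ : ∀ x y → blockDiag (m ∷ N) hs (m ↑ʳ x) (y ↑ˡ sum N) ≡ 0F
    blockDiag-↑ʳ-↑ˡ x y rewrite splitAt-↑ʳ m (sum N) x | splitAt-↑ˡ m y (sum N) = ≡.refl

    blockDiag-↑ˡ-↑ʳ : ∀ x y → blockDiag (m ∷ N) hs (x ↑ˡ sum N) (m ↑ʳ y) ≡ 0F
    blockDiag-↑ˡ-↑ʳ x y rewrite splitAt-↑ˡ m x (sum N) | splitAt-↑ʳ m (sum N) y = ≡.refl

    blockDiag-↑ʳ-↑ʳ : ∀ x y → blockDiag (m ∷ N) hs (m ↑ʳ x) (m ↑ʳ y) ≡ blockDiag N (hs ∘ suc) x y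
    blockDiag-↑ʳ-↑ʳ x y rewrite splitAt-↑ʳ m (sum N) x | splitAt-↑ʳ m (sum N) y = ≡.refl

  ·ᵣ-zero : ∀ {a b} (w : Fin a → 𝔽) (A : Matrix a b) k → (∀ r → A r k ≡ 0F) → (w ·ᵣ A) k ≡ 0F
  ·ᵣ-zero w A k A≡0 = ΣF-zero (λ r → ≡.trans (cong (w r *F_) (A≡0 r)) (𝔽.zeroʳ (w r)))

  ·ᵣ-blockDiag-col : ∀ {l} (N : Vec ℕ l) (hs : Elems N) (w : Fin (sum N) → 𝔽) i k →
                     (w ·ᵣ blockDiag N hs) (col N i k) ≡ ((w ∘ col N i) ·ᵣ jmat (hs i)) k
  ·ᵣ-blockDiag-col (m ∷ N) hs w zero k = begin
    (w ·ᵣ blockDiag (m ∷ N) hs) (k ↑ˡ sum N)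
      ≡⟨ ΣF-↑ m _ ⟩
    ((w ∘ (_↑ˡ sum N)) ·ᵣ (λ x → blockDiag (m ∷ N) hs (x ↑ˡ sum N))) (k ↑ˡ sum N)
      +F ((w ∘ (m ↑ʳ_)) ·ᵣ (λ y → blockDiag (m ∷ N) hs (m ↑ʳ y))) (k ↑ˡ sum N)
      ≡⟨ cong₂ _+F_ (ΣF-cong (λ x → cong (w (x ↑ˡ sum N) *F_) (blockDiag-↑ˡ-↑ˡ m N hs x k)))
                    (·ᵣ-zero (w ∘ (m ↑ʳ_)) (λ y → blockDiag (m ∷ N) hs (m ↑ʳ y)) (k ↑ˡ sum N) (λ y → blockDiag-↑ʳ-↑ˡ m N hs y k)) ⟩
    ((w ∘ (_↑ˡ sum N)) ·ᵣ jmat (hs zero)) k +F 0F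
      ≡⟨ 𝔽.+-identityʳ _ ⟩
    ((w ∘ (_↑ˡ sum N)) ·ᵣ jmat (hs zero)) k
      ∎
    where open ≡.≡-Reasoning
  ·ᵣ-blockDiag-col (m ∷ N) hs w (suc i) k = begin
    (w ·ᵣ blockDiag (m ∷ N) hs) (m ↑ʳ col N i k)
      ≡⟨ ΣF-↑ m _ ⟩
    ((w ∘ (_↑ˡ sum N)) ·ᵣ (λ x → blockDiag (m ∷ N) hs (x ↑ˡ sum N))) (m ↑ʳ col N i k)
      +F ((w ∘ (m ↑ʳ_)) ·ᵣ (λ y → blockDiag (m ∷ N) hs (m ↑ʳ y))) (m ↑ʳ col N i k)
      ≡⟨ cong₂ _+F_ (·ᵣ-zero (w ∘ (_↑ˡ sum N)) (λ x → blockDiag (m ∷ N) hs (x ↑ˡ sum N)) (m ↑ʳ col N i k) (λ x → blockDiag-↑ˡ-↑ʳ m N hs x (col N i k)))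
                    (ΣF-cong (λ y → cong (w (m ↑ʳ y) *F_) (blockDiag-↑ʳ-↑ʳ m N hs y (col N i k)))) ⟩
    0F +F ((w ∘ (m ↑ʳ_)) ·ᵣ blockDiag N (hs ∘ suc)) (col N i k)
      ≡⟨ 𝔽.+-identityˡ _ ⟩
    ((w ∘ (m ↑ʳ_)) ·ᵣ blockDiag N (hs ∘ suc)) (col N i k)
      ≡⟨ ·ᵣ-blockDiag-col N (hs ∘ suc) (w ∘ (m ↑ʳ_)) i k ⟩
    ((w ∘ (m ↑ʳ_) ∘ col N i) ·ᵣ jmat (hs (suc i))) k
      ∎
    where open ≡.≡-Reasoning

  ·ᵣ-jmat : ∀ {m} (v h : Vec 𝔽 m) k → (lookup v ·ᵣ jmat h) k ≡ lookup (v ⋆ h) k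
  ·ᵣ-jmat v h k = ≡.trans (ΣF-cong move-into-if) (≡.sym (lookup∘tabulate _ k))
    where
    move-into-if : ∀ r → lookup v r *F jmat h r k ≡
                         (if toℕ r ℕ.≤ᵇ toℕ k then lookup v r *F lookupℕ h (toℕ k ℕ.∸ toℕ r) else 0F)
    move-into-if r = ≡.trans (if-float (lookup v r *F_) (toℕ r ℕ.≤ᵇ toℕ k))
                             (if-cong-else (toℕ r ℕ.≤ᵇ toℕ k) (𝔽.zeroʳ (lookup v r)))

  block-·-blockDiag : ∀ {l d} (N : Vec ℕ l) (s : Vec 𝔽 d) (z : Matrix d (sum N)) (hs : Elems N) i →
                      block N s (z · blockDiag N hs) i ≡ block N s z i ⋆ hs i
  block-·-blockDiag N s z hs i = ≡.trans (tabulate-cong λ k → begin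
    (lookup s ·ᵣ (z · blockDiag N hs)) (col N i k)         ≡⟨ ·ᵣ-assoc (lookup s) z (blockDiag N hs) (col N i k) ⟩
    ((lookup s ·ᵣ z) ·ᵣ blockDiag N hs) (col N i k)        ≡⟨ ·ᵣ-blockDiag-col N hs (lookup s ·ᵣ z) i k ⟩
    (((lookup s ·ᵣ z) ∘ col N i) ·ᵣ jmat (hs i)) k         ≡⟨ ·ᵣ-congˡ (jmat (hs i)) (lookup∘tabulate _) k ⟨
    (lookup (block N s z i) ·ᵣ jmat (hs i)) k              ≡⟨ ·ᵣ-jmat (block N s z i) (hs i) k ⟩
    lookup (block N s z i ⋆ hs i) k                        ∎) (tabulate∘lookup _)
    where open ≡.≡-Reasoning

  head-⋆ : ∀ {m} (v h : Vec 𝔽 m) → lookupℕ (v ⋆ h) 0 ≡ lookupℕ v 0 *F lookupℕ h 0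
  head-⋆ []      []      = ≡.sym (𝔽.zeroˡ 0F)
  head-⋆ {suc m} (a ∷ v) (b ∷ h) = ≡.trans (cong ((a *F b) +F_) (ΣF-zero {m} {λ _ → 0F} (λ _ → ≡.refl))) (𝔽.+-identityʳ (a *F b))

  *-≢0 : ∀ {a b} → a ≢ 0F → b ≢ 0F → a *F b ≢ 0F
  *-≢0 {a} {b} a≢0 b≢0 ab≡0 = b≢0 (begin
    b                   ≡⟨ 𝔽.*-identityˡ b ⟨
    1F *F b             ≡⟨ cong (_*F b) (inverseʳ a a≢0) ⟨
    (a *F (a ⁻¹)) *F b  ≡⟨ cong (_*F b) (𝔽.*-comm a (a ⁻¹)) ⟩
    ((a ⁻¹) *F a) *F b  ≡⟨ 𝔽.*-assoc (a ⁻¹) a b ⟩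
    (a ⁻¹) *F (a *F b)  ≡⟨ cong ((a ⁻¹) *F_) ab≡0 ⟩
    (a ⁻¹) *F 0F        ≡⟨ 𝔽.zeroʳ (a ⁻¹) ⟩
    0F                  ∎)
    where open ≡.≡-Reasoning

  evalJ-⋆ : ∀ {m} (χ : JChar m) (v h : Vec 𝔽 m) → InJ h → evalJ χ (v ⋆ h) ≈ evalJ χ v * JChar.χ χ h
  evalJ-⋆ χ v h h∈J with lookupℕ (v ⋆ h) 0 ≟ 0F | lookupℕ v 0 ≟ 0F
  ... | yes _    | yes _    = sym (zeroˡ _)
  ... | yes vh≡0 | no v≢0   = ⊥-elim (*-≢0 v≢0 h∈J (≡.trans (≡.sym (head-⋆ v h)) vh≡0))
  ... | no vh≢0  | yes v≡0  = ⊥-elim (vh≢0 (≡.trans (head-⋆ v h) (≡.trans (cong (_*F _) v≡0) (𝔽.zeroˡ _))))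
  ... | no _     | no v≢0   = JChar.hom χ v h v≢0 h∈J

  Φ-right-equivariant : ∀ {l d} (N : Vec ℕ l) (χ : CharH N) (z : Matrix d (sum N)) (hs : Elems N) →
                        InH N hs → Φ N χ (z · blockDiag N hs) ≈ evalH N χ hs * Φ N χ z
  Φ-right-equivariant {d = d} N χ z hs hs∈H = begin
    Φ N χ (z · blockDiag N hs)
      ≈⟨ ΣVec-cong d (λ s → ΠR-cong (λ i → reflexive (cong (evalJ (χ i)) (block-·-blockDiag N s z hs i)))) ⟩
    ΣVec d (λ s → ΠR (λ i → evalJ (χ i) (block N s z i ⋆ hs i)))
      ≈⟨ ΣVec-cong d (λ s → ΠR-cong (λ i → evalJ-⋆ (χ i) (block N s z i) (hs i) (hs∈H i))) ⟩
    ΣVec d (λ s → ΠR (λ i → evalJ (χ i) (block N s z i) * JChar.χ (χ i) (hs i)))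
      ≈⟨ ΣVec-cong d (λ s → trans (ΠR-* (λ i → evalJ (χ i) (block N s z i)) (λ i → JChar.χ (χ i) (hs i))) (*-comm _ _)) ⟩
    ΣVec d (λ s → evalH N χ hs * ΠR (λ i → evalJ (χ i) (block N s z i)))
      ≈⟨ ΣVec-*ˡ d (evalH N χ hs) _ ⟩
    evalH N χ hs * Φ N χ z
      ∎
    where open import Relation.Binary.Reasoning.Setoid setoid

proposition3p4 : {c ℓ : Level} (F : FiniteField) (R : CommutativeRing c ℓ) →
    let open Hyper F R in (l : ℕ) (N : Vec ℕ l) →
    (∀ i → 1 ≤ lookup N i) →
    (∀ i j → i ≤ᶠ j → lookup N i ≤ lookup N j) →
    (∀ i → lookup N i ≤ FiniteField.p F) →
    (d : ℕ) (z : Matrix d (sum N)) (χ : CharH N) →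
    ((g : Matrix d d) → IsInvertible g → Φ N χ (g · z) ≈ᴿ Φ N χ z)
    × ((hs : Elems N) → InH N hs → Φ N χ (z · blockDiag N hs) ≈ᴿ (evalH N χ hs *ᴿ Φ N χ z))
proposition3p4 F R l N _ _ _ d z χ =
  Φ-left-invariant N χ z , Φ-right-equivariant N χ z
  where open HypergeometricSymmetries F R
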